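{- Let $\mathsf L$ be $\mathsf K_n\mathbf D$ or $\mathsf D_n\mathbf D$, $P\subseteq\mathcal P$ finite, $p\in P$, $k\ge0$ and $\delta\in D^P_k(\mathsf L)$. For every $\mathsf L$-model $(M',s')$ with $M',s'\models\delta^p$ there is an $\mathsf L$-model $(M,s)$ with $M,s\models\delta$ that is collectively $p$-bisimilar to $(M',s')$.
   Context: Fix a finite nonempty set $\mathcal A$ of $n$ agents and a countable set $\mathcal P$ of atoms; $\mathcal P^+(\mathcal A)$ is the set of nonempty subsets of $\mathcal A$. Models $(S,R,V)$: $\mathbf D_{\mathcal B}$ is the box for $R_{\mathcal B}=\bigcap_{i\in\mathcal B}R_i$, $\hat{\mathbf D}_{\mathcal B}=\neg\mathbf D_{\mathcal B}\neg$. $\mathsf K_n\mathbf D$-models are all models; $\mathsf D_n\mathbf D$-models are those in which every $R_i$ is serial; $D^P_k(\mathsf L)$ consists of the members of $D^P_k$ true in some $\mathsf L$-model. $\nabla_{\mathcal B}\Phi=\mathbf D_{\mathcal B}(\bigvee\Phi)\wedge\bigwedge\{\hat{\mathbf D}_{\mathcal B}\phi\mid\phi\in\Phi\}$. $D^P_0$: minterms of $P$; $D^P_{k+1}$: formulas $\delta_0\wedge\bigwedge_{\mathcal B\in\mathcal P^+(\mathcal A)}\nabla_{\mathcal B}\Phi_{\mathcal B}$ with $\delta_0\in D^P_0$, $\Phi_{\mathcal B}\subseteq D^P_k$. $\delta^p$ is obtained from $\delta$ by replacing every occurrence of $\neg p$ by $\top$ and subsequently every remaining occurrence of $p$ by $\top$.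 Collective $p$-bisimilarity of $(M,s)$ and $(M',s')$: there is a relation $\rho\ni(s,s')$ such that related worlds agree on every atom other than $p$ and, for every $\mathcal C\in\mathcal P^+(\mathcal A)$, every $R_{\mathcal C}$-successor of one related world is $\rho$-related to some $R'_{\mathcal C}$-successor of the other, and vice versa. -}

module Defs where

open import Data.Nat using (ℕ; zero; suc)
open import Data.Bool using (Bool; true; false)
open import Data.Fin using (Fin)
open import Data.Fin.Subset using (Subset; _∈_)
open import Data.Fin.Subset.Properties using (nonempty?)
open import Data.List using (List; []; _∷_; map; foldr; filter; length; _++_)
open import Data.Vec using (Vec; []; _∷_)
open import Data.Product using (Σ; ∃; _×_; _,_)
open import Data.Sum using (_⊎_)
open import Data.Unit using (⊤)
open import Data.Empty using (⊥)
open import Relation.Nullary using (¬_)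
open import Relation.Binary.PropositionalEquality using (_≡_; _≢_)
open import Function.Bundles using (_⇔_)

-- The diamond D̂_B is a primitive connective (read: ¬ D_B ¬), so that the
-- syntactic operation δ^p never touches the negations hidden inside it.

data Fm (n : ℕ) : Set where
  var  : ℕ → Fm n
  tt   : Fm n
  ff   : Fm n
  neg  : Fm n → Fm n
  _∧_  : Fm n → Fm n → Fm n
  _∨_  : Fm n → Fm n → Fm n
  box  : Subset n → Fm n → Fm n
  dia  : Subset n → Fm n → Fm n

⋀ : ∀ {n} → List (Fm n) → Fm n
⋀ = foldr _∧_ tt

⋁ : ∀ {n} → List (Fm n) → Fm n
⋁ = foldr _∨_ ff

∇ : ∀ {n} → Subset n → List (Fm n) → Fm n
∇ B Φ = box B (⋁ Φ) ∧ ⋀ (map (dia B) Φ)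

allSubsets : (n : ℕ) → List (Subset n)
allSubsets zero    = [] ∷ []
allSubsets (suc n) = map (true ∷_) (allSubsets n) ++ map (false ∷_) (allSubsets n)

nonemptySubsets : (n : ℕ) → List (Subset n)
nonemptySubsets n = filter nonempty? (allSubsets n)

-- Disjunctive normal forms D^P_k.  P is a finite set of atoms given as a
-- duplicate-free list.  A minterm of P chooses a polarity for each atom.

literal : ∀ {n} → Bool → ℕ → Fm n
literal true  q = var q
literal false q = neg (var q)

Minterm : List ℕ → Set
Minterm P = Vec Bool (length P)

mintermFm : ∀ {n} (P : List ℕ) → Minterm P → Fm n
mintermFm []      []       = tt
mintermFm (q ∷ P) (b ∷ bs) = literal b q ∧ mintermFm P bs

-- Codes for members of D^P_k: level 0 a minterm; level k+1 a minterm δ₀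
-- together with a finite set Φ_B ⊆ D^P_k for each coalition B (the value at
-- the empty coalition is ignored).
NF : (n : ℕ) → List ℕ → ℕ → Set
NF n P zero    = Minterm P
NF n P (suc k) = Minterm P × (Subset n → List (NF n P k))

nfFm : ∀ {n} (P : List ℕ) (k : ℕ) → NF n P k → Fm n
nfFm {n} P zero    δ₀        = mintermFm P δ₀
nfFm {n} P (suc k) (δ₀ , Φ)  =
  mintermFm P δ₀ ∧ ⋀ (map (λ B → ∇ B (map (nfFm P k) (Φ B))) (nonemptySubsets n))

dropNegP : ∀ {n} → ℕ → Fm n → Fm n
dropNegP p (var q)   = var q
dropNegP p tt        = tt
dropNegP p ff        = ff
dropNegP p (neg (var q)) with Data.Nat._≟_ q p
... | Relation.Nullary.yes _ = tt
... | Relation.Nullary.no  _ = neg (var q)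
dropNegP p (neg φ)   = neg (dropNegP p φ)
dropNegP p (φ ∧ ψ)   = dropNegP p φ ∧ dropNegP p ψ
dropNegP p (φ ∨ ψ)   = dropNegP p φ ∨ dropNegP p ψ
dropNegP p (box B φ) = box B (dropNegP p φ)
dropNegP p (dia B φ) = dia B (dropNegP p φ)

dropP : ∀ {n} → ℕ → Fm n → Fm n
dropP p (var q) with Data.Nat._≟_ q p
... | Relation.Nullary.yes _ = tt
... | Relation.Nullary.no  _ = var q
dropP p tt        = tt
dropP p ff        = ff
dropP p (neg φ)   = neg (dropP p φ)
dropP p (φ ∧ ψ)   = dropP p φ ∧ dropP p ψ
dropP p (φ ∨ ψ)   = dropP p φ ∨ dropP p ψ
dropP p (box B φ) = box B (dropP p φ)
dropP p (dia B φ) = dia B (dropP p φ)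

_^_ : ∀ {n} → Fm n → ℕ → Fm n
δ ^ p = dropP p (dropNegP p δ)

record Model (n : ℕ) : Set₁ where
  field
    S : Set
    R : Fin n → S → S → Set
    V : ℕ → S → Bool

open Model public

RB : ∀ {n} (M : Model n) → Subset n → S M → S M → Set
RB M B s t = ∀ i → i ∈ B → R M i s t

_,_⊨_ : ∀ {n} (M : Model n) → S M → Fm n → Set
M , s ⊨ var q   = V M q s ≡ true
M , s ⊨ tt      = ⊤
M , s ⊨ ff      = ⊥
M , s ⊨ neg φ   = ¬ (M , s ⊨ φ)
M , s ⊨ (φ ∧ ψ) = (M , s ⊨ φ) × (M , s ⊨ ψ)
M , s ⊨ (φ ∨ ψ) = (M , s ⊨ φ) ⊎ (M , s ⊨ ψ)
M , s ⊨ box B φ = ∀ t → RB M B s t → M , t ⊨ φ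
M , s ⊨ dia B φ = ∃ λ t → RB M B s t × (M , t ⊨ φ)

data Logic : Set where
  KnD DnD : Logic

IsModelOf : ∀ {n} → Logic → Model n → Set
IsModelOf KnD M = ⊤
IsModelOf DnD M = ∀ i s → ∃ λ t → R M i s t

InDL : ∀ {n} → Logic → (P : List ℕ) (k : ℕ) → NF n P k → Set₁
InDL {n} L P k δ =
  Σ (Model n) λ M → IsModelOf L M × (∃ λ s → M , s ⊨ nfFm P k δ)

CollBisim : ∀ {n} → ℕ → (M : Model n) → S M → (M' : Model n) → S M' → Set₁
CollBisim {n} p M s M' s' =
  Σ (S M → S M' → Set) λ ρ →
    ρ s s' ×
    (∀ w w' → ρ w w' →
       (∀ q → q ≢ p → V M q w ≡ V M' q w') ×
       (∀ (C : Subset n) → Data.Fin.Subset.Nonempty C →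
          (∀ t → RB M C w t → ∃ λ t' → RB M' C w' t' × ρ t t') ×
          (∀ t' → RB M' C w' t' → ∃ λ t → RB M C w t × ρ t t')))

{-# OPTIONS --safe #-}
module Submission where

-- If δ holds in an L-model, then δ is coherent: each of its minterms gives p a single
-- sign, for B ⊆ C every member of Φ_C is equivalent to a member of Φ_B (both hold at a
-- common R_C-successor), and for D_nD every Φ_{i} is nonempty.  Given M', s' ⊨ δ^p, unfold
-- δ along M': a node is a subformula φ of δ together with a world w' of M' satisfying φ^p,
-- where p gets the sign prescribed by φ's minterm; the children of (φ, w') are the nodes
-- (ψ, v') with ψ ∈ Φ_C and v' an R'_C-successor of w', and below level 0 the model
-- continues as a copy of M'.  Coherence makes the ∇-boxes true, δ^p provides the
-- ∇-diamonds and the back condition, and projecting every world to M' is the collective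
-- p-bisimulation.

open import Defs
open import Data.Nat using (ℕ; zero; suc; _≤_; _≟_)
open import Data.Bool using (Bool; true; false)
open import Data.Bool.Properties using (¬-not; not-¬)
open import Data.Fin using (Fin)
open import Data.Fin.Subset using (Subset; Nonempty; _⊆_; ⁅_⁆) renaming (_∈_ to _∈ₛ_; ⊥ to ∅)
open import Data.Fin.Subset.Properties using (nonempty?; x∈⁅x⁆; x∈⁅y⁆⇒x≡y)
open import Data.List using (List; []; _∷_; map)
open import Data.Vec using ([]; _∷_)
open import Data.List.Properties using (map-∘; map-cong)
open import Data.List.Relation.Unary.All as All using (All; []; _∷_)
import Data.List.Relation.Unary.All.Properties as Allₚ
open import Data.List.Relation.Unary.Any as Any using (Any; here; there)
import Data.List.Relation.Unary.Any.Properties as Anyₚ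
open import Data.List.Membership.Propositional using (_∈_; find)
open import Data.List.Membership.Propositional.Properties
  using (∈-map⁺; ∈-filter⁺; ∈-filter⁻; ∈-++⁺ˡ; ∈-++⁺ʳ)
open import Data.List.Relation.Unary.Unique.Propositional using (Unique)
open import Data.Product using (Σ; ∃; _×_; _,_; proj₁; proj₂)
open import Data.Sum using (inj₁; inj₂)
open import Data.Unit using (⊤; tt)
open import Data.Empty using (⊥-elim)
open import Function using (_∘_)
open import Relation.Nullary using (yes; no)
open import Relation.Nullary.Decidable using (dec-no)
open import Relation.Binary.PropositionalEquality
  using (_≡_; _≢_; refl; sym; trans; cong; cong₂; subst; module ≡-Reasoning)

∈-allSubsets : ∀ {n} (B : Subset n) → B ∈ allSubsets n
∈-allSubsets []          = here refl
∈-allSubsets (true ∷ B)  = ∈-++⁺ˡ (∈-map⁺ (true ∷_) (∈-allSubsets B))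
∈-allSubsets (false ∷ B) = ∈-++⁺ʳ _ (∈-map⁺ (false ∷_) (∈-allSubsets B))

∈-nonemptySubsets⁺ : ∀ {n} {B : Subset n} → Nonempty B → B ∈ nonemptySubsets n
∈-nonemptySubsets⁺ {B = B} = ∈-filter⁺ nonempty? (∈-allSubsets B)

∈-nonemptySubsets⁻ : ∀ {n} {B : Subset n} → B ∈ nonemptySubsets n → Nonempty B
∈-nonemptySubsets⁻ {n} = proj₂ ∘ ∈-filter⁻ nonempty? {xs = allSubsets n}

RB-⁅⁆ : ∀ {n} {M : Model n} {i s t} → R M i s t → RB M ⁅ i ⁆ s t
RB-⁅⁆ {M = M} {s = s} {t} r j j∈ = subst (λ i → R M i s t) (sym (x∈⁅y⁆⇒x≡y _ j∈)) r

RB-⊆ : ∀ {n} {M : Model n} {B C s t} → B ⊆ C → RB M C s t → RB M B s t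
RB-⊆ B⊆C r i i∈B = r i (B⊆C i∈B)

Cover : ∀ {n} {A : Set} (M : Model n) → S M → Subset n → (A → S M → Set) → List A → Set
Cover M s B holds Φ =
  (∀ t → RB M B s t → Any (λ φ → holds φ t) Φ) × All (λ φ → ∃ λ t → RB M B s t × holds φ t) Φ

-- nfFm P (suc k) (m , Φ) is definitionally mintermFm P m ∧ ⋀∇ Φ (nfFm P k).
⋀∇ : ∀ {n} {A : Set} → (Subset n → List A) → (A → Fm n) → Fm n
⋀∇ {n} Φ f = ⋀ (map (λ B → ∇ B (map f (Φ B))) (nonemptySubsets n))

module _ {n : ℕ} {M : Model n} {s : S M} where

  ⊨⋀⁺ : ∀ {φs} → All (M , s ⊨_) φs → M , s ⊨ ⋀ φs
  ⊨⋀⁺ []       = tt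
  ⊨⋀⁺ (h ∷ hs) = h , ⊨⋀⁺ hs

  ⊨⋀⁻ : ∀ {φs} → M , s ⊨ ⋀ φs → All (M , s ⊨_) φs
  ⊨⋀⁻ {[]}    _        = []
  ⊨⋀⁻ {_ ∷ _} (h , hs) = h ∷ ⊨⋀⁻ hs

  ⊨⋁⁺ : ∀ {φs} → Any (M , s ⊨_) φs → M , s ⊨ ⋁ φs
  ⊨⋁⁺ (here h)   = inj₁ h
  ⊨⋁⁺ (there hs) = inj₂ (⊨⋁⁺ hs)

  ⊨⋁⁻ : ∀ {φs} → M , s ⊨ ⋁ φs → Any (M , s ⊨_) φs
  ⊨⋁⁻ {_ ∷ _} (inj₁ h)  = here h
  ⊨⋁⁻ {_ ∷ _} (inj₂ hs) = there (⊨⋁⁻ hs)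

  ⊨literal⁺ : ∀ c {q} → V M q s ≡ c → M , s ⊨ literal c q
  ⊨literal⁺ true  e = e
  ⊨literal⁺ false e = not-¬ e

  ⊨literal⁻ : ∀ c {q} → M , s ⊨ literal c q → V M q s ≡ c
  ⊨literal⁻ true  h = h
  ⊨literal⁻ false h = ¬-not h

  ⊨minterm-unique : ∀ Q {m m' : Minterm Q} → M , s ⊨ mintermFm Q m → M , s ⊨ mintermFm Q m' → m ≡ m'
  ⊨minterm-unique []      {[]}    {[]}      _        _          = refl
  ⊨minterm-unique (_ ∷ Q) {c ∷ _} {c' ∷ _} (l , ls) (l' , ls') =
    cong₂ _∷_ (trans (sym (⊨literal⁻ c l)) (⊨literal⁻ c' l')) (⊨minterm-unique Q ls ls')

module _ {n : ℕ} {M : Model n} {s : S M} {A : Set} {f : A → Fm n} where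

  ⊨∇⁺ : ∀ {B Φ} → Cover M s B (λ φ t → M , t ⊨ f φ) Φ → M , s ⊨ ∇ B (map f Φ)
  ⊨∇⁺ (□ , ◇) = (λ t r → ⊨⋁⁺ (Anyₚ.map⁺ (□ t r))) , ⊨⋀⁺ (Allₚ.map⁺ (Allₚ.map⁺ ◇))

  ⊨∇⁻ : ∀ {B Φ} → M , s ⊨ ∇ B (map f Φ) → Cover M s B (λ φ t → M , t ⊨ f φ) Φ
  ⊨∇⁻ (□ , ◇) = (λ t r → Anyₚ.map⁻ (⊨⋁⁻ (□ t r))) , Allₚ.map⁻ (Allₚ.map⁻ (⊨⋀⁻ ◇))

  ⊨⋀∇⁺ : ∀ {Φ} → (∀ {B} → Nonempty B → Cover M s B (λ φ t → M , t ⊨ f φ) (Φ B)) →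
         M , s ⊨ ⋀∇ Φ f
  ⊨⋀∇⁺ cover = ⊨⋀⁺ (Allₚ.map⁺ (All.tabulate (⊨∇⁺ ∘ cover ∘ ∈-nonemptySubsets⁻)))

  ⊨⋀∇⁻ : ∀ {Φ} → M , s ⊨ ⋀∇ Φ f →
         ∀ {B} → Nonempty B → Cover M s B (λ φ t → M , t ⊨ f φ) (Φ B)
  ⊨⋀∇⁻ h B≠∅ = ⊨∇⁻ (All.lookup (Allₚ.map⁻ (⊨⋀⁻ h)) (∈-nonemptySubsets⁺ B≠∅))

Polarity : ℕ → Bool → (Q : List ℕ) → Minterm Q → Set
Polarity p b []      []       = ⊤
Polarity p b (q ∷ Q) (c ∷ cs) = (q ≡ p → c ≡ b) × Polarity p b Q cs

module _ {n : ℕ} (p : ℕ) where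

  ^-⋀-map : ∀ {A : Set} (f : A → Fm n) xs → ⋀ (map f xs) ^ p ≡ ⋀ (map (λ x → f x ^ p) xs)
  ^-⋀-map f []       = refl
  ^-⋀-map f (x ∷ xs) = cong ((f x ^ p) ∧_) (^-⋀-map f xs)

  ^-⋁-map : ∀ {A : Set} (f : A → Fm n) xs → ⋁ (map f xs) ^ p ≡ ⋁ (map (λ x → f x ^ p) xs)
  ^-⋁-map f []       = refl
  ^-⋁-map f (x ∷ xs) = cong ((f x ^ p) ∨_) (^-⋁-map f xs)

  ^-∇-map : ∀ {A : Set} B (f : A → Fm n) xs → ∇ B (map f xs) ^ p ≡ ∇ B (map (λ x → f x ^ p) xs)
  ^-∇-map B f xs = cong₂ _∧_ (cong (box B) (^-⋁-map f xs)) (begin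
    ⋀ (map (dia B) (map f xs)) ^ p             ≡⟨ cong (λ φs → ⋀ φs ^ p) (map-∘ xs) ⟨
    ⋀ (map (dia B ∘ f) xs) ^ p                 ≡⟨ ^-⋀-map (dia B ∘ f) xs ⟩
    ⋀ (map (λ x → dia B (f x ^ p)) xs)         ≡⟨ cong ⋀ (map-∘ xs) ⟩
    ⋀ (map (dia B) (map (λ x → f x ^ p) xs))   ∎)
    where open ≡-Reasoning

  ^-⋀∇ : ∀ {A : Set} (Φ : Subset n → List A) (f : A → Fm n) → ⋀∇ Φ f ^ p ≡ ⋀∇ Φ (λ φ → f φ ^ p)
  ^-⋀∇ Φ f = trans (^-⋀-map (λ B → ∇ B (map f (Φ B))) (nonemptySubsets n))
                   (cong ⋀ (map-cong (λ B → ^-∇-map B f (Φ B)) (nonemptySubsets n)))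

  ^-literal-≢ : ∀ c {q} → q ≢ p → literal {n} c q ^ p ≡ literal c q
  ^-literal-≢ true  {q} q≢p rewrite dec-no (q ≟ p) q≢p = refl
  ^-literal-≢ false {q} q≢p rewrite dec-no (q ≟ p) q≢p | dec-no (q ≟ p) q≢p = refl

  ⊨⋀∇^⁻ : ∀ {M : Model n} {s} {A : Set} {f : A → Fm n} {Φ} → M , s ⊨ (⋀∇ Φ f ^ p) →
          ∀ {B} → Nonempty B → Cover M s B (λ φ t → M , t ⊨ (f φ ^ p)) (Φ B)
  ⊨⋀∇^⁻ {M = M} {s} {f = f} {Φ} h = ⊨⋀∇⁻ {Φ = Φ} (subst (M , s ⊨_) (^-⋀∇ Φ f) h)

  ⊨minterm⇒Polarity : ∀ {M : Model n} {s} Q {m} → M , s ⊨ mintermFm Q m → Polarity p (V M p s) Q m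
  ⊨minterm⇒Polarity []      {[]}    _        = tt
  ⊨minterm⇒Polarity (_ ∷ Q) {c ∷ _} (l , ls) =
    (λ { refl → sym (⊨literal⁻ c l) }) , ⊨minterm⇒Polarity Q ls

  module _ {N M' : Model n} {x : S N} {w' : S M'} {b : Bool}
           (agree : ∀ q → q ≢ p → V N q x ≡ V M' q w') (p↦b : V N p x ≡ b) where

    ⊨literal-^ : ∀ c {q} → (q ≡ p → c ≡ b) → M' , w' ⊨ (literal c q ^ p) → N , x ⊨ literal c q
    ⊨literal-^ c {q} pol l with q ≟ p
    ... | yes refl = ⊨literal⁺ c (trans p↦b (sym (pol refl)))
    ... | no q≢p   =
      ⊨literal⁺ c (trans (agree q q≢p) (⊨literal⁻ c (subst (M' , w' ⊨_) (^-literal-≢ c q≢p) l)))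

    ⊨minterm-^ : ∀ Q {m} → Polarity p b Q m → M' , w' ⊨ (mintermFm Q m ^ p) → N , x ⊨ mintermFm Q m
    ⊨minterm-^ []      {[]}    _            _        = tt
    ⊨minterm-^ (_ ∷ Q) {c ∷ _} (pol , pols) (l , ls) = ⊨literal-^ c pol l , ⊨minterm-^ Q pols ls

module _ {n : ℕ} (P : List ℕ) where

  -- A syntactic equivalence of normal forms, small enough to be carried by the worlds of
  -- the witness model below (semantic equivalence would live in Set₁).
  Equiv : ∀ k → NF n P k → NF n P k → Set
  Equiv zero    m       m'        = m ≡ m'
  Equiv (suc k) (m , Φ) (m' , Φ') = m ≡ m' × (∀ {B} → Nonempty B →
    All (λ φ → Any (Equiv k φ) (Φ' B)) (Φ B) × All (λ φ' → Any (λ φ → Equiv k φ φ') (Φ B)) (Φ' B))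

  ⊨⇒Equiv : ∀ k {a b} {M : Model n} {s} → M , s ⊨ nfFm P k a → M , s ⊨ nfFm P k b → Equiv k a b
  ⊨⇒Equiv zero    ha        hb         = ⊨minterm-unique P ha hb
  ⊨⇒Equiv (suc k) {_ , Φ} {_ , Φ'} (hm , ha) (hm' , hb) = ⊨minterm-unique P hm hm' , λ B≠∅ →
    let (□a , ◇a) = ⊨⋀∇⁻ {Φ = Φ} ha B≠∅
        (□b , ◇b) = ⊨⋀∇⁻ {Φ = Φ'} hb B≠∅
    in All.map (λ { (t , r , hφ)  → Any.map (⊨⇒Equiv k hφ) (□b t r) }) ◇a ,
       All.map (λ { (t , r , hφ') → Any.map (λ hφ → ⊨⇒Equiv k hφ hφ') (□a t r) }) ◇b

  ⊨-resp-Equiv : ∀ k {a b} {M : Model n} {s} → Equiv k a b → M , s ⊨ nfFm P k a → M , s ⊨ nfFm P k b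
  ⊨-resp-Equiv zero    refl       h        = h
  ⊨-resp-Equiv (suc k) {_ , Φ} {_ , Φ'} (refl , eq) (hm , h) = hm , ⊨⋀∇⁺ {Φ = Φ'} λ B≠∅ →
    let (□ , ◇)        = ⊨⋀∇⁻ {Φ = Φ} h B≠∅
        (forth , back) = eq B≠∅
    in (λ t r → let (φ , φ∈ , hφ) = find (□ t r)
                in Any.map (λ e → ⊨-resp-Equiv k e hφ) (All.lookup forth φ∈)) ,
       All.map (λ φ≈ → let (φ , φ∈ , e) = find φ≈
                           (t , r , hφ)  = All.lookup ◇ φ∈
                       in t , r , ⊨-resp-Equiv k e hφ) back

module _ {n : ℕ} (P : List ℕ) (p : ℕ) where

  Serial : ∀ {A : Set} → Logic → (Subset n → List A) → Set
  Serial KnD Φ = ⊤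
  Serial DnD Φ = ∀ i → ∃ λ φ → φ ∈ Φ ⁅ i ⁆

  record CoherentNode (L : Logic) {k} (Coherentₖ : NF n P k → Set)
                      (m : Minterm P) (Φ : Subset n → List (NF n P k)) : Set where
    field
      bit      : Bool
      polarity : Polarity p bit P m
      children : ∀ {B} → Nonempty B → All Coherentₖ (Φ B)
      monotone : ∀ {B C} → Nonempty B → B ⊆ C → All (λ φ → Any (Equiv P k φ) (Φ B)) (Φ C)
      serial   : Serial L Φ

  Coherent : Logic → ∀ k → NF n P k → Set
  Coherent L zero    m       = Σ Bool λ b → Polarity p b P m
  Coherent L (suc k) (m , Φ) = CoherentNode L (Coherent L k) m Φ

  ⊨⇒Coherent : ∀ L k {δ} {N : Model n} {u} → IsModelOf L N → N , u ⊨ nfFm P k δ → Coherent L k δ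
  ⊨⇒Coherent L zero    {N = N} {u} _   h        = V N p u , ⊨minterm⇒Polarity p P h
  ⊨⇒Coherent L (suc k) {_ , Φ} {N} {u} N-L (hm , h) = record
    { bit      = V N p u
    ; polarity = ⊨minterm⇒Polarity p P hm
    ; children = λ B≠∅ → All.map (λ { (_ , _ , hφ) → ⊨⇒Coherent L k N-L hφ }) (proj₂ (cover B≠∅))
    ; monotone = monotone
    ; serial   = serial L N-L
    }
    where
    cover : ∀ {B} → Nonempty B → Cover N u B (λ φ t → N , t ⊨ nfFm P k φ) (Φ B)
    cover = ⊨⋀∇⁻ {Φ = Φ} h

    monotone : ∀ {B C} → Nonempty B → B ⊆ C → All (λ φ → Any (Equiv P k φ) (Φ B)) (Φ C)
    monotone B≠∅@(i , i∈B) B⊆C = All.map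
      (λ { (t , r , hφ) → Any.map (⊨⇒Equiv P k hφ) (proj₁ (cover B≠∅) t (RB-⊆ {M = N} B⊆C r)) })
      (proj₂ (cover (i , B⊆C i∈B)))

    serial : ∀ L → IsModelOf L N → Serial L Φ
    serial KnD _        = tt
    serial DnD N-serial i =
      let (t , r)       = N-serial i u
          (φ , φ∈ , _) = find (proj₁ (cover (i , x∈⁅x⁆ i)) t (RB-⁅⁆ {M = N} r))
      in φ , φ∈

  module Witness (L : Logic) (M' : Model n) where

    record Obligation (k : ℕ) : Set where
      constructor obligation
      field
        nf       : NF n P k
        coherent : Coherent L k nf
        world    : S M'
        holds    : M' , world ⊨ (nfFm P k nf ^ p)

    open Obligation public

    data World : Set where
      base : S M' → World
      node : ∀ k → Obligation k → Subset n → World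

    under : World → S M'
    under (base w')     = w'
    under (node _ x _) = world x

    -- A node remembers the coalition it was reached through and is seen only by its members,
    -- so the R_B-successors of a node are children taken from lists Φ_C with B ⊆ C.
    data Edge (i : Fin n) : World → World → Set where
      along   : ∀ {w' v'} → R M' i w' v' → Edge i (base w') (base v')
      exit    : ∀ {x C v'} → R M' i (world x) v' → Edge i (node zero x C) (base v')
      descend : ∀ {k x C₀ y C} → i ∈ₛ C → nf y ∈ proj₂ (nf x) C → RB M' C (world x) (world y) →
                Edge i (node (suc k) x C₀) (node k y C)

    pValue : ∀ k {δ} → Coherent L k δ → Bool
    pValue zero    c = proj₁ c
    pValue (suc k) c = CoherentNode.bit c

    val : ℕ → World → Bool
    val q (base w') = V M' q w'
    val q (node k x _) with q ≟ p
    ... | yes _ = pValue k (coherent x)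
    ... | no  _ = V M' q (world x)

    model : Model n
    model = record { S = World ; R = Edge ; V = val }

    val-≢ : ∀ u q → q ≢ p → val q u ≡ V M' q (under u)
    val-≢ (base _)     q q≢p = refl
    val-≢ (node _ _ _) q q≢p rewrite dec-no (q ≟ p) q≢p = refl

    val-p : ∀ k x C → val p (node k x C) ≡ pValue k (coherent x)
    val-p k x C with p ≟ p
    ... | yes _   = refl
    ... | no p≢p = ⊥-elim (p≢p refl)

    edge-under : ∀ {i u t} → Edge i u t → R M' i (under u) (under t)
    edge-under (along r)         = r
    edge-under (exit r)          = r
    edge-under (descend i∈C _ r) = r _ i∈C

    descend-coalition : ∀ {j k x C₀ y C} → Edge j (node (suc k) x C₀) (node k y C) → j ∈ₛ C
    descend-coalition (descend j∈C _ _) = j∈C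

    cover-holds : ∀ {k} (x : Obligation (suc k)) {B} → Nonempty B →
                  Cover M' (world x) B (λ φ t → M' , t ⊨ (nfFm P k φ ^ p)) (proj₂ (nf x) B)
    cover-holds x = ⊨⋀∇^⁻ p {Φ = proj₂ (nf x)} (proj₂ (holds x))

    child : ∀ {k} (x : Obligation (suc k)) {B φ} → Nonempty B → φ ∈ proj₂ (nf x) B →
            (v' : S M') → M' , v' ⊨ (nfFm P k φ ^ p) → Obligation k
    child x B≠∅ φ∈ = obligation _ (All.lookup (CoherentNode.children (coherent x) B≠∅) φ∈)

    truth : ∀ k (x : Obligation k) C → model , node k x C ⊨ nfFm P k (nf x)
    truth zero x C =
      ⊨minterm-^ p (val-≢ (node zero x C)) (val-p zero x C) P (proj₂ (coherent x)) (holds x)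
    truth (suc k) x C₀ =
      ⊨minterm-^ p (val-≢ root) (val-p (suc k) x C₀) P
        (CoherentNode.polarity (coherent x)) (proj₁ (holds x)) ,
      ⊨⋀∇⁺ {Φ = proj₂ (nf x)} cover
      where
      root = node (suc k) x C₀

      successors : ∀ {B i t} → Nonempty B → Edge i root t → RB model B root t →
                   Any (λ φ → model , t ⊨ nfFm P k φ) (proj₂ (nf x) B)
      successors B≠∅ (descend {y = y} {C = C} _ y∈ _) r =
        let B⊆C = λ {j} j∈B → descend-coalition (r j j∈B)
        in Any.map (λ e → ⊨-resp-Equiv P k e (truth k y C))
                   (All.lookup (CoherentNode.monotone (coherent x) B≠∅ B⊆C) y∈)

      cover : ∀ {B} → Nonempty B →
              Cover model root B (λ φ t → model , t ⊨ nfFm P k φ) (proj₂ (nf x) B)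
      cover B≠∅@(i , i∈B) =
        (λ t r → successors B≠∅ (r i i∈B) r) ,
        All.tabulate λ φ∈ →
          let (v' , r , h) = All.lookup (proj₂ (cover-holds x B≠∅)) φ∈
          in node k (child x B≠∅ φ∈ v' h) _ , (λ j j∈ → descend j∈ φ∈ r) , truth k _ _

    forth : ∀ u {C} t → RB model C u t → ∃ λ t' → RB M' C (under u) t' × under t ≡ t'
    forth u t r = under t , (λ i i∈ → edge-under (r i i∈)) , refl

    back : ∀ u {C} → Nonempty C →
           ∀ t' → RB M' C (under u) t' → ∃ λ t → RB model C u t × under t ≡ t'
    back (base _)           _   t' r = base t' , (λ i i∈ → along (r i i∈)) , refl
    back (node zero _ _)    _   t' r = base t' , (λ i i∈ → exit (r i i∈)) , refl
    back (node (suc k) x _) C≠∅ t' r =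
      let (φ , φ∈ , h) = find (proj₁ (cover-holds x C≠∅) t' r)
      in node k (child x C≠∅ φ∈ t' h) _ , (λ i i∈ → descend i∈ φ∈ r) , refl

    collBisim : ∀ u → CollBisim p model u M' (under u)
    collBisim u = (λ t t' → under t ≡ t') , refl ,
                  λ { t _ refl → val-≢ t , λ C C≠∅ → forth t , back t C≠∅ }

  open Witness using (base; node; along; exit; descend; model; world; coherent; cover-holds; child)

  witness-isModelOf : ∀ L {M'} → IsModelOf L M' → IsModelOf L (model L M')
  witness-isModelOf KnD _ = tt
  witness-isModelOf DnD M'-serial i (base w') =
    let (v' , r) = M'-serial i w' in base v' , along r
  witness-isModelOf DnD M'-serial i (node zero x _) =
    let (v' , r) = M'-serial i (world x) in base v' , exit r
  witness-isModelOf DnD {M'} M'-serial i (node (suc k) x _) =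
    let (φ , φ∈)    = CoherentNode.serial (coherent x) i
        i∈⁅i⁆       = x∈⁅x⁆ i
        (v' , r , h) = All.lookup (proj₂ (cover-holds DnD M' x (i , i∈⁅i⁆))) φ∈
    in node k (child DnD M' x (i , i∈⁅i⁆) φ∈ v' h) ⁅ i ⁆ , descend i∈⁅i⁆ φ∈ r

lemma4p1 : (n : ℕ) → 1 ≤ n → (L : Logic) (P : List ℕ) → Unique P →
           (p : ℕ) → p ∈ P → (k : ℕ) (δ : NF n P k) → InDL L P k δ →
           (M' : Model n) → IsModelOf L M' → (s' : S M') →
           M' , s' ⊨ (nfFm P k δ ^ p) →
           Σ (Model n) λ M → IsModelOf L M ×
             Σ (S M) λ s → (M , s ⊨ nfFm P k δ) × CollBisim p M s M' s'
lemma4p1 n _ L P _ p _ k δ (N , N-L , u , u⊨δ) M' M'-L s' s'⊨δ^p =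
  model , witness-isModelOf P p L M'-L , node k x ∅ , truth k x ∅ , collBisim (node k x ∅)
  where
  open Witness P p L M'
  x : Obligation k
  x = obligation δ (⊨⇒Coherent P p L k N-L u⊨δ) s' s'⊨δ^p
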